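{- Let $P$ be a finite graded poset of rank $r$, $\mathbb{K}$ a field of characteristic zero, $C\in\mathbb{K}$ a generic constant, $g\in\mathbb{K}^P$ and $(a_0,\dots,a_r)\in(\mathbb{K}^\times)^{r+1}$. Then for each $0\le i\le r$, $$\tau_{\langle i\rangle}\big((a_0,\dots,a_r)\flat g\big)=\Big(a_0,\dots,a_{i-1},\frac{1}{a_0a_1\cdots a_r},a_{i+1},\dots,a_r\Big)\flat\,\tau_{\langle i\rangle}g.$$
   Context: A finite poset is graded of rank $r$ if it has a rank function $\operatorname{rk}$ with minimal elements of rank $0$, $\operatorname{rk}(y)=\operatorname{rk}(x)+1$ whenever $y$ covers $x$, and all maximal elements of rank $r$. $\mathbb{K}^P$ is the set of labelings $g:P\to\mathbb{K}$. The birational antichain toggle $\tau_v$ ($v\in P$) changes only the label at $v$: $(\tau_vg)(v)=C/\sum g(y_1)\cdots g(y_k)$, the sum over all maximal chains $(y_1,\dots,y_k)$ of $P$ containing $v$. The rank toggle $\tau_{\langle i\rangle}=\prod_{\operatorname{rk}(x)=i}\tau_x$ (these toggles commute). The graded rescaling $(a_0,\dots,a_r)\flat g$ is the labeling obtained from $g$ by multiplying the label of every element of rank $i$ by $a_i$, for each $i$. -}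

module Defs where

open import Level using (Level; _⊔_)
open import Algebra.Bundles using (CommutativeRing)
open import Data.Nat as ℕ using (ℕ; zero; suc)
open import Data.Fin as Fin using (Fin; toℕ; fromℕ)
open import Data.Fin.Properties using (_≟_)
open import Data.Bool using (Bool; true; false; _∧_; if_then_else_; not)
open import Data.List using (List; []; _∷_; _++_; map; foldr; filter)
open import Data.List as List using ()
open import Data.Vec using (Vec; []; _∷_; lookup)
open import Data.Product using (_×_; _,_)
open import Data.Sum using (_⊎_)
open import Relation.Nullary using (¬_; Dec; yes; no)
open import Relation.Nullary.Decidable using (⌊_⌋; _⊎-dec_)
open import Relation.Binary using (Rel; IsPartialOrder; Decidable)
open import Relation.Binary.PropositionalEquality using (_≡_)

-- A commutative ring together with a (total) inverse operation which is
-- a genuine multiplicative inverse on every nonzero element, and 0 ≠ 1.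
-- (The value 0⁻¹ is irrelevant junk; it is never used under the
-- hypotheses of the theorem.)

record Field (c ℓ : Level) : Set (Level.suc (c ⊔ ℓ)) where
  field
    commutativeRing : CommutativeRing c ℓ
  open CommutativeRing commutativeRing public
  field
    _⁻¹       : Carrier → Carrier
    ⁻¹-inverse : ∀ x → ¬ (x ≈ 0#) → (x * (x ⁻¹)) ≈ 1#
    0≉1       : ¬ (0# ≈ 1#)

  ℕ→K : ℕ → Carrier
  ℕ→K zero    = 0#
  ℕ→K (suc n) = 1# + ℕ→K n

CharacteristicZero : ∀ {c ℓ} → Field c ℓ → Set ℓ
CharacteristicZero K = ∀ n → ¬ (ℕ→K (suc n) ≈ 0#)
  where open Field K

record FinPoset (n : ℕ) : Set₁ where
  field
    _≤_            : Rel (Fin n) Level.zero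
    isPartialOrder : IsPartialOrder _≡_ _≤_
    _≤?_           : Decidable _≤_

  _<_ : Rel (Fin n) Level.zero
  x < y = x ≤ y × ¬ (x ≡ y)

  _⋖_ : Rel (Fin n) Level.zero
  x ⋖ y = x < y × (∀ z → x < z → ¬ (z < y))

  IsMinimal : Fin n → Set
  IsMinimal x = ∀ y → y ≤ x → y ≡ x

  IsMaximal : Fin n → Set
  IsMaximal x = ∀ y → x ≤ y → x ≡ y

  comparable? : Fin n → Fin n → Bool
  comparable? x y = ⌊ (x ≤? y) ⊎-dec (y ≤? x) ⌋

record IsGraded {n : ℕ} (P : FinPoset n) (r : ℕ) (rk : Fin n → Fin (suc r)) : Set where
  open FinPoset P
  field
    minimal-rank : ∀ x → IsMinimal x → toℕ (rk x) ≡ 0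
    cover-rank   : ∀ x y → x ⋖ y → toℕ (rk y) ≡ suc (toℕ (rk x))
    maximal-rank : ∀ x → IsMaximal x → rk x ≡ fromℕ r

allSubsets : (n : ℕ) → List (Vec Bool n)
allSubsets zero    = [] ∷ []
allSubsets (suc n) = map (true ∷_) (allSubsets n) ++ map (false ∷_) (allSubsets n)

allFin : (n : ℕ) → List (Fin n)
allFin n = List.allFin n

all? : ∀ {n} → (Fin n → Bool) → Bool
all? {n} p = foldr (λ x b → p x ∧ b) true (allFin n)

any? : ∀ {n} → (Fin n → Bool) → Bool
any? p = not (all? (λ x → not (p x)))

_⇒ᵇ_ : Bool → Bool → Bool
a ⇒ᵇ b = not a Data.Bool.∨ b

module Chains {n : ℕ} (P : FinPoset n) where
  open FinPoset P

  isChain : Vec Bool n → Bool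
  isChain s = all? (λ x → all? (λ y → (lookup s x ∧ lookup s y) ⇒ᵇ comparable? x y))

  isMaximalChain : Vec Bool n → Bool
  isMaximalChain s =
    isChain s ∧ all? (λ x → lookup s x Data.Bool.∨
                            any? (λ y → lookup s y ∧ not (comparable? x y)))

  maximalChainsThrough : Fin n → List (Vec Bool n)
  maximalChainsThrough v = List.filterᵇ (λ s → isMaximalChain s ∧ lookup s v) (allSubsets n)

module Toggles {c ℓ} (K : Field c ℓ) {n : ℕ} (P : FinPoset n) where
  open Field K
  open Chains P

  Labeling : Set c
  Labeling = Fin n → Carrier

  Σ : List Carrier → Carrier
  Σ = foldr _+_ 0#

  chainWeight : Labeling → Vec Bool n → Carrier
  chainWeight g s = foldr (λ x acc → (if lookup s x then g x else 1#) * acc) 1# (allFin n)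

  chainSum : Labeling → Fin n → Carrier
  chainSum g v = Σ (map (chainWeight g) (maximalChainsThrough v))

  toggle : Carrier → Fin n → Labeling → Labeling
  toggle C v g w with w ≟ v
  ... | yes _ = C * (chainSum g v ⁻¹)
  ... | no  _ = g w

  -- the rank toggle τ⟨i⟩ : composite of τ_x over all x of rank i
  -- (in the order of Fin n; these toggles commute)
  rankToggle : ∀ {r} → (Fin n → Fin (suc r)) → Carrier → Fin (suc r) → Labeling → Labeling
  rankToggle rk C i g =
    foldr (λ x h → if ⌊ rk x ≟ i ⌋ then toggle C x h else h) g (allFin n)

  rescale : ∀ {r} → (Fin n → Fin (suc r)) → (Fin (suc r) → Carrier) → Labeling → Labeling
  rescale rk a g x = a (rk x) * g x

  prodAll : ∀ {r} → (Fin (suc r) → Carrier) → Carrier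
  prodAll {r} a = foldr (λ j acc → a j * acc) 1# (allFin (suc r))

  replaceAt : ∀ {r} → (Fin (suc r) → Carrier) → Fin (suc r) → Carrier → Fin (suc r) → Carrier
  replaceAt a i b j = if ⌊ j ≟ i ⌋ then b else a j

  _≋_ : Labeling → Labeling → Set ℓ
  g ≋ h = ∀ x → g x ≈ h x

module Submission where

-- 1. In a graded poset the rank strictly increases along <  (induction on the
--    size of the open interval (x, y)), so a maximal chain through v meets
--    every rank 0,…,r exactly once (its lowest member is minimal in P, the
--    lowest member above x covers x, and a member of rank < r is not maximal).
-- 2. Hence the weight of such a chain picks up exactly one factor aⱼ per rank,
--    so rescaling multiplies every chain sum by A = a₀⋯a_r; and the chain sum
--    at v depends only on the labels at v and at elements of other ranks.
-- 3. By 2, the toggles making up τ⟨i⟩ act in parallel: each rank-i label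
--    becomes C / (chain sum of the original labeling), the rest are unchanged.
-- 4. Since C/(A·S) = A⁻¹·(C/S), the proposition follows pointwise, by cases on
--    whether the rank of the point is i.

open import Defs
import Level
open import Data.Nat as ℕ using (ℕ; zero; suc)
import Data.Nat.Properties as ℕ
open import Data.Nat.Induction using (<-wellFounded)
open import Induction.WellFounded using (Acc; acc)
open import Data.Fin as Fin using (Fin; toℕ; punchIn)
open import Data.Fin.Properties
  using (_≟_; toℕ-injective; toℕ-fromℕ; toℕ≤pred[n]; punchInᵢ≢i)
  renaming (any? to anyFin?)
open import Data.Fin.Subset using (Subset; _∈_; _⊂_; ∣_∣)
open import Data.Fin.Subset.Properties using (p⊂q⇒∣p∣<∣q∣)
open import Data.Bool using (Bool; true; false; T; not; _∧_; if_then_else_)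
open import Data.Bool.Properties using (T-≡; T-∧; T-∨)
open import Data.Unit using (tt)
open import Data.Vec as Vec using (Vec; lookup)
open import Data.Vec.Properties using (lookup∘tabulate; []=⇒lookup; lookup⇒[]=)
open import Data.List as List using (List; []; _∷_; foldr; map)
import Data.List.Membership.Propositional as List
open import Data.List.Membership.Propositional.Properties using (∈-allFin; ∈-filter⁻)
open import Data.List.Properties using (map-cong-local)
open import Data.List.Relation.Unary.Any using (here; there)
import Data.List.Relation.Unary.All as All
open import Data.List.Relation.Unary.AllPairs using (_∷_)
open import Data.List.Relation.Unary.Unique.Propositional using (Unique)
open import Data.List.Relation.Unary.Unique.Propositional.Properties using (allFin⁺)
open import Data.Product using (∃; _×_; _,_; proj₁; proj₂)
open import Data.Sum using (_⊎_; inj₁; inj₂)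
open import Data.Empty using (⊥; ⊥-elim)
open import Function using (_∘_; Equivalence)
open import Relation.Nullary using (¬_; Dec; yes; no; ¬?)
open import Relation.Nullary.Decidable using (⌊_⌋; _×-dec_; T?; toWitness; fromWitness)
open import Relation.Unary as U using (Pred)
open import Relation.Binary using (IsPartialOrder)
open import Relation.Binary.PropositionalEquality using (_≡_; _≢_; refl; sym; trans; cong; cong₂)

open Equivalence using (to; from)

T-not : ∀ {b} → T (not b) → ¬ T b
T-not {false} _ ()

¬T⇒T-not : ∀ {b} → ¬ T b → T (not b)
¬T⇒T-not {false} _ = tt
¬T⇒T-not {true}  ¬t = ⊥-elim (¬t tt)

foldr-∧-sound : ∀ {A : Set} (p : A → Bool) (xs : List A) →
  T (foldr (λ x b → p x ∧ b) true xs) → ∀ {x} → x List.∈ xs → T (p x)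
foldr-∧-sound p (y ∷ ys) h (here refl) = proj₁ (to T-∧ h)
foldr-∧-sound p (y ∷ ys) h (there m)   = foldr-∧-sound p ys (proj₂ (to (T-∧ {p y}) h)) m

foldr-∧-complete : ∀ {A : Set} (p : A → Bool) (xs : List A) →
  (∀ x → T (p x)) → T (foldr (λ x b → p x ∧ b) true xs)
foldr-∧-complete p []       h = tt
foldr-∧-complete p (y ∷ ys) h = from T-∧ (h y , foldr-∧-complete p ys h)

module _ {n : ℕ} where

  all?-sound : (p : Fin n → Bool) → T (all? p) → ∀ x → T (p x)
  all?-sound p h x = foldr-∧-sound p (allFin n) h (∈-allFin x)

  any?-sound : (p : Fin n → Bool) → T (any? p) → ∃ λ x → T (p x)
  any?-sound p h with anyFin? (λ x → T? (p x))
  ... | yes witness = witness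
  ... | no none = ⊥-elim (T-not h (foldr-∧-complete (not ∘ p) (allFin n)
                                     (λ x → ¬T⇒T-not (λ px → none (x , px)))))

-- Every satisfiable decidable predicate on Fin n has a witness minimising a
-- given ℕ-valued measure (descend while a smaller witness exists).
minimiser : ∀ {n} {Q : Pred (Fin n) Level.zero} → U.Decidable Q → (f : Fin n → ℕ) →
  ∀ {x} → Q x → ∃ λ u → Q u × (∀ w → Q w → f u ℕ.≤ f w)
minimiser {n} {Q} Q? f {x} qx = descend x (<-wellFounded (f x)) qx
  where
  descend : ∀ x → Acc ℕ._<_ (f x) → Q x → ∃ λ u → Q u × (∀ w → Q w → f u ℕ.≤ f w)
  descend x (acc smaller) qx with anyFin? (λ w → Q? w ×-dec (f w ℕ.<? f x))
  ... | yes (w , qw , w<x) = descend w (smaller w<x) qw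
  ... | no none = x , qx , λ w qw → ℕ.≮⇒≥ (λ w<x → none (w , qw , w<x))

module _ {n : ℕ} {Q : Pred (Fin n) Level.zero} (Q? : U.Decidable Q) where

  subsetOf : Subset n
  subsetOf = Vec.tabulate (λ w → ⌊ Q? w ⌋)

  ∈-subsetOf⁺ : ∀ {w} → Q w → w ∈ subsetOf
  ∈-subsetOf⁺ {w} q = lookup⇒[]= w subsetOf
    (trans (lookup∘tabulate _ w) (to T-≡ (fromWitness q)))

  ∈-subsetOf⁻ : ∀ {w} → w ∈ subsetOf → Q w
  ∈-subsetOf⁻ {w} m = toWitness (from T-≡ (trans (sym (lookup∘tabulate _ w)) ([]=⇒lookup m)))

subsetOf-⊂ : ∀ {n} {Q R : Pred (Fin n) Level.zero} (Q? : U.Decidable Q) (R? : U.Decidable R) →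
  (∀ w → Q w → R w) → ∀ {z} → R z → ¬ Q z → subsetOf Q? ⊂ subsetOf R?
subsetOf-⊂ Q? R? Q⇒R {z} rz ¬qz =
  (λ m → ∈-subsetOf⁺ R? (Q⇒R _ (∈-subsetOf⁻ Q? m))) ,
  z , ∈-subsetOf⁺ R? rz , (λ m → ¬qz (∈-subsetOf⁻ Q? m))

module Graded {n : ℕ} (P : FinPoset n) {r : ℕ} {rk : Fin n → Fin (suc r)} (G : IsGraded P r rk) where
  open FinPoset P
  open IsGraded G
  open IsPartialOrder isPartialOrder using (antisym) renaming (trans to ≤-trans)
  open Chains P

  ρ : Fin n → ℕ
  ρ x = toℕ (rk x)

  <-dec : ∀ x y → Dec (x < y)
  <-dec x y = (x ≤? y) ×-dec ¬? (x ≟ y)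

  <-irrefl : ∀ {x} → ¬ (x < x)
  <-irrefl (_ , x≢x) = x≢x refl

  <-trans : ∀ {x y z} → x < y → y < z → x < z
  <-trans {y = y} (x≤y , x≢y) (y≤z , _) =
    ≤-trans x≤y y≤z , λ { refl → x≢y (antisym x≤y y≤z) }

  ≤⇒<⊎≡ : ∀ {x y} → x ≤ y → x < y ⊎ x ≡ y
  ≤⇒<⊎≡ {x} {y} x≤y with x ≟ y
  ... | yes x≡y = inj₂ x≡y
  ... | no  x≢y = inj₁ (x≤y , x≢y)

  -- The open interval (x, y) as a subset; its size is the induction measure below.
  between? : ∀ x y w → Dec (x < w × w < y)
  between? x y w = <-dec x w ×-dec <-dec w y

  interval : Fin n → Fin n → Subset n
  interval x y = subsetOf (between? x y)

  -- If nothing lies strictly between x < y, then y covers x and the rank goes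
  -- up by one; otherwise split at an intermediate z, whose two intervals are smaller.
  rank-increases : ∀ {x y} → x < y → ρ x ℕ.< ρ y
  rank-increases {x} {y} = go x y (<-wellFounded ∣ interval x y ∣)
    where
    go : ∀ x y → Acc ℕ._<_ ∣ interval x y ∣ → x < y → ρ x ℕ.< ρ y
    go x y (acc smaller) x<y with anyFin? (between? x y)
    ... | no nothing-between =
      ℕ.≤-reflexive (sym (cover-rank x y (x<y , λ z x<z z<y → nothing-between (z , x<z , z<y))))
    ... | yes (z , x<z , z<y) = ℕ.<-trans (go x z (smaller left) x<z) (go z y (smaller right) z<y)
      where
      left : ∣ interval x z ∣ ℕ.< ∣ interval x y ∣
      left = p⊂q⇒∣p∣<∣q∣ (subsetOf-⊂ (between? x z) (between? x y)
               (λ w (x<w , w<z) → x<w , <-trans w<z z<y) (x<z , z<y) (λ (_ , z<z) → <-irrefl z<z))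
      right : ∣ interval z y ∣ ℕ.< ∣ interval x y ∣
      right = p⊂q⇒∣p∣<∣q∣ (subsetOf-⊂ (between? z y) (between? x y)
                (λ w (z<w , w<y) → <-trans x<z z<w , w<y) (x<z , z<y) (λ (z<z , _) → <-irrefl z<z))

  module MaximalChain (s : Vec Bool n) (maximal : T (isMaximalChain s)) where

    InChain : Fin n → Set
    InChain x = T (lookup s x)

    comparable : ∀ {x y} → InChain x → InChain y → x ≤ y ⊎ y ≤ x
    comparable {x} {y} x∈s y∈s with to T-∨ (all?-sound _ (all?-sound _ isChain-s x) y)
      where isChain-s = proj₁ (to T-∧ maximal)
    ... | inj₁ ¬both = ⊥-elim (T-not ¬both (from T-∧ (x∈s , y∈s)))
    ... | inj₂ x~y   = toWitness x~y

    saturated : ∀ {z} → (∀ t → InChain t → z ≤ t ⊎ t ≤ z) → InChain z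
    saturated {z} z~s with to T-∨ (all?-sound _ (proj₂ (to (T-∧ {isChain s}) maximal)) z)
    ... | inj₁ z∈s = z∈s
    ... | inj₂ h with any?-sound _ h
    ... | t , t∈s∧z≁t with to T-∧ t∈s∧z≁t
    ... | t∈s , z≁t = ⊥-elim (T-not z≁t (fromWitness (z~s t t∈s)))

    below-bound : ∀ {u z t} → InChain u → InChain t → z ≤ u → ¬ (t < u) → z ≤ t
    below-bound u∈s t∈s z≤u t≮u with comparable t∈s u∈s
    ... | inj₂ u≤t = ≤-trans z≤u u≤t
    ... | inj₁ t≤u with ≤⇒<⊎≡ t≤u
    ...   | inj₁ t<u  = ⊥-elim (t≮u t<u)
    ...   | inj₂ refl = z≤u

    above-bound : ∀ {x z t} → InChain x → InChain t → x ≤ z → ¬ (x < t) → t ≤ z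
    above-bound x∈s t∈s x≤z x≮t with comparable t∈s x∈s
    ... | inj₁ t≤x = ≤-trans t≤x x≤z
    ... | inj₂ x≤t with ≤⇒<⊎≡ x≤t
    ...   | inj₁ x<t  = ⊥-elim (x≮t x<t)
    ...   | inj₂ refl = x≤z

    rank-injective : ∀ {x y} → InChain x → InChain y → rk x ≡ rk y → x ≡ y
    rank-injective {x} {y} x∈s y∈s rx≡ry with x ≟ y
    ... | yes x≡y = x≡y
    ... | no x≢y with comparable x∈s y∈s
    ...   | inj₁ x≤y = ⊥-elim (ℕ.<-irrefl (cong toℕ rx≡ry) (rank-increases (x≤y , x≢y)))
    ...   | inj₂ y≤x = ⊥-elim (ℕ.<-irrefl (cong toℕ (sym rx≡ry)) (rank-increases (y≤x , x≢y ∘ sym)))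

    -- A member of s of least rank is minimal in P, hence has rank 0.
    bottom-rank : ∀ {u} → InChain u → (∀ t → InChain t → ρ u ℕ.≤ ρ t) → ρ u ≡ 0
    bottom-rank {u} u∈s u-least = minimal-rank u is-minimal
      where
      not-below : ∀ {t} → InChain t → ¬ (t < u)
      not-below t∈s t<u = ℕ.<⇒≱ (rank-increases t<u) (u-least _ t∈s)
      is-minimal : IsMinimal u
      is-minimal y y≤u with ≤⇒<⊎≡ y≤u
      ... | inj₂ y≡u = y≡u
      ... | inj₁ y<u = ⊥-elim (not-below y∈s y<u)
        where y∈s = saturated (λ t t∈s → inj₁ (below-bound u∈s t∈s y≤u (not-below t∈s)))

    -- Above a member x of s of rank below r, s contains a member of the next rank:
    -- the lowest member above x covers x, since a gap would be filled by maximality.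
    next-rank : ∀ {x} → InChain x → ρ x ℕ.< r → ∃ λ u → InChain u × ρ u ≡ suc (ρ x)
    next-rank {x} x∈s ρx<r with anyFin? (λ w → T? (lookup s w) ×-dec <-dec x w)
    ... | no nothing-above = ⊥-elim (ℕ.<-irrefl ρx≡r ρx<r)
      where
      is-maximal : IsMaximal x
      is-maximal y x≤y with ≤⇒<⊎≡ x≤y
      ... | inj₂ x≡y = x≡y
      ... | inj₁ x<y = ⊥-elim (nothing-above (y , y∈s , x<y))
        where
        y∈s = saturated (λ t t∈s →
                inj₂ (above-bound x∈s t∈s x≤y (λ x<t → nothing-above (t , t∈s , x<t))))
      ρx≡r : ρ x ≡ r
      ρx≡r = trans (cong toℕ (maximal-rank x is-maximal)) (toℕ-fromℕ r)
    ... | yes (w , w∈s , x<w) with minimiser (λ w → T? (lookup s w) ×-dec <-dec x w) ρ (w∈s , x<w)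
    ... | u , (u∈s , x<u) , u-least = u , u∈s , cover-rank x u (x<u , no-gap)
      where
      not-below : ∀ {t} → InChain t → x < t → ¬ (t < u)
      not-below t∈s x<t t<u = ℕ.<⇒≱ (rank-increases t<u) (u-least _ (t∈s , x<t))
      no-gap : ∀ z → x < z → ¬ (z < u)
      no-gap z x<z z<u = ℕ.<⇒≱ (rank-increases z<u) (u-least z (z∈s , x<z))
        where
        z∈s : InChain z
        z∈s = saturated λ t t∈s → case (<-dec x t) t∈s
          where
          case : ∀ {t} → Dec (x < t) → InChain t → z ≤ t ⊎ t ≤ z
          case (yes x<t) t∈s = inj₁ (below-bound u∈s t∈s (proj₁ z<u) (not-below t∈s x<t))
          case (no x≮t)  t∈s = inj₂ (above-bound x∈s t∈s (proj₁ x<z) x≮t)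

    every-rank : ∀ {v} → InChain v → ∀ k → k ℕ.≤ r → ∃ λ x → InChain x × ρ x ≡ k
    every-rank v∈s zero _ with minimiser (λ w → T? (lookup s w)) ρ v∈s
    ... | u , u∈s , u-least = u , u∈s , bottom-rank u∈s u-least
    every-rank v∈s (suc k) k<r with every-rank v∈s k (ℕ.<⇒≤ k<r)
    ... | x , x∈s , refl = next-rank x∈s k<r

    element-of-rank : ∀ {v} → InChain v → ∀ j → ∃ λ x → InChain x × rk x ≡ j
    element-of-rank v∈s j with every-rank v∈s (toℕ j) (toℕ≤pred[n] j)
    ... | x , x∈s , ρx≡j = x , x∈s , toℕ-injective ρx≡j

module FieldFacts {c ℓ} (K : Field c ℓ) where
  open Field K renaming (refl to ≈-refl; sym to ≈-sym; trans to ≈-trans)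
  open import Relation.Binary.Reasoning.Setoid setoid
  open import Algebra.Properties.CommutativeSemigroup *-commutativeSemigroup
    using (interchange; x∙yz≈y∙xz)
  open import Algebra.Properties.CommutativeMonoid.Sum *-commutativeMonoid
    using (sum-remove; sum-replicate-zero)
  open import Algebra.Properties.CommutativeMonoid.Sum *-commutativeMonoid
    using (sum-cong-≋; sum-cong-≗)
    renaming (sum to ∏; ∑-distrib-+ to ∏-distrib-*; ∑-comm to ∏-comm)
    public

  _≉0 : Carrier → Set ℓ
  x ≉0 = ¬ (x ≈ 0#)

  *-≉0 : ∀ {x y} → x ≉0 → y ≉0 → (x * y) ≉0
  *-≉0 {x} {y} x≉0 y≉0 xy≈0 = y≉0 (begin
    y                ≈⟨ ≈-sym (*-identityˡ y) ⟩
    1# * y           ≈⟨ *-cong (≈-sym (≈-trans (*-comm _ _) (⁻¹-inverse x x≉0))) ≈-refl ⟩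
    (x ⁻¹ * x) * y   ≈⟨ *-assoc _ _ _ ⟩
    x ⁻¹ * (x * y)   ≈⟨ *-cong ≈-refl xy≈0 ⟩
    x ⁻¹ * 0#        ≈⟨ zeroʳ _ ⟩
    0#               ∎)

  ⁻¹-unique : ∀ {x y} → x ≉0 → x * y ≈ 1# → y ≈ x ⁻¹
  ⁻¹-unique {x} {y} x≉0 xy≈1 = begin
    y                ≈⟨ ≈-sym (*-identityʳ y) ⟩
    y * 1#           ≈⟨ *-cong ≈-refl (≈-sym (⁻¹-inverse x x≉0)) ⟩
    y * (x * x ⁻¹)   ≈⟨ ≈-sym (*-assoc _ _ _) ⟩
    (y * x) * x ⁻¹   ≈⟨ *-cong (≈-trans (*-comm y x) xy≈1) ≈-refl ⟩
    1# * x ⁻¹        ≈⟨ *-identityˡ _ ⟩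
    x ⁻¹             ∎

  ⁻¹-cong : ∀ {x y} → x ≉0 → x ≈ y → x ⁻¹ ≈ y ⁻¹
  ⁻¹-cong {x} {y} x≉0 x≈y =
    ⁻¹-unique (λ y≈0 → x≉0 (≈-trans x≈y y≈0))
              (≈-trans (*-cong (≈-sym x≈y) ≈-refl) (⁻¹-inverse x x≉0))

  ⁻¹-distrib-* : ∀ {x y} → x ≉0 → y ≉0 → (x * y) ⁻¹ ≈ x ⁻¹ * y ⁻¹
  ⁻¹-distrib-* {x} {y} x≉0 y≉0 = ≈-sym (⁻¹-unique (*-≉0 x≉0 y≉0) (begin
    (x * y) * (x ⁻¹ * y ⁻¹)    ≈⟨ interchange x y (x ⁻¹) (y ⁻¹) ⟩
    (x * x ⁻¹) * (y * y ⁻¹)    ≈⟨ *-cong (⁻¹-inverse x x≉0) (⁻¹-inverse y y≉0) ⟩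
    1# * 1#                    ≈⟨ *-identityˡ 1# ⟩
    1#                         ∎))

  reciprocal-rescale : ∀ (C : Carrier) {A S S′} → A ≉0 → S ≉0 → S′ ≈ A * S →
    C * S′ ⁻¹ ≈ A ⁻¹ * (C * S ⁻¹)
  reciprocal-rescale C {A} {S} {S′} A≉0 S≉0 S′≈AS = begin
    C * S′ ⁻¹          ≈⟨ *-cong ≈-refl (⁻¹-cong S′≉0 S′≈AS) ⟩
    C * (A * S) ⁻¹     ≈⟨ *-cong ≈-refl (⁻¹-distrib-* A≉0 S≉0) ⟩
    C * (A ⁻¹ * S ⁻¹)  ≈⟨ x∙yz≈y∙xz C (A ⁻¹) (S ⁻¹) ⟩
    A ⁻¹ * (C * S ⁻¹)  ∎
    where
    S′≉0 : S′ ≉0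
    S′≉0 S′≈0 = *-≉0 A≉0 S≉0 (≈-trans (≈-sym S′≈AS) S′≈0)

  foldr-tabulate : ∀ {A : Set} {n} (h : Fin n → A) (f : A → Carrier) →
    foldr (λ x acc → f x * acc) 1# (List.tabulate h) ≡ ∏ (f ∘ h)
  foldr-tabulate {n = zero}  h f = refl
  foldr-tabulate {n = suc n} h f = cong (f (h Fin.zero) *_) (foldr-tabulate (h ∘ Fin.suc) f)

  ∏-≉0 : ∀ {n} (f : Fin n → Carrier) → (∀ j → f j ≉0) → ∏ f ≉0
  ∏-≉0 {zero}  f f≉0 1≈0 = 0≉1 (≈-sym 1≈0)
  ∏-≉0 {suc n} f f≉0 = *-≉0 (f≉0 Fin.zero) (∏-≉0 (f ∘ Fin.suc) (f≉0 ∘ Fin.suc))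

  ∏-single : ∀ {n} (f : Fin n → Carrier) (i : Fin n) → (∀ j → j ≢ i → f j ≈ 1#) → ∏ f ≈ f i
  ∏-single {suc n} f i others = begin
    ∏ f                          ≈⟨ sum-remove f ⟩
    f i * ∏ (f ∘ punchIn i)      ≈⟨ *-cong ≈-refl rest ⟩
    f i * 1#                     ≈⟨ *-identityʳ _ ⟩
    f i                          ∎
    where
    rest : ∏ (f ∘ punchIn i) ≈ 1#
    rest = ≈-trans (sum-cong-≋ (λ k → others (punchIn i k) (punchInᵢ≢i i k))) (sum-replicate-zero n)

module _ {a} {A : Set a} {u v : A} where
  if-T : ∀ {b} → T b → (if b then u else v) ≡ u
  if-T {true} _ = refl

  if-¬T : ∀ {b} → ¬ T b → (if b then u else v) ≡ v
  if-¬T {false} _  = refl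
  if-¬T {true}  ¬t = ⊥-elim (¬t tt)

module ChainSums {c ℓ} (K : Field c ℓ) {n : ℕ} (P : FinPoset n)
                 {r : ℕ} {rk : Fin n → Fin (suc r)} (G : IsGraded P r rk) where
  open Field K renaming (refl to ≈-refl; sym to ≈-sym; trans to ≈-trans)
  open import Relation.Binary.Reasoning.Setoid setoid
  open FieldFacts K
  open Toggles K P
  open Chains P
  open Graded P G using (module MaximalChain)

  restrict : Vec Bool n → Labeling → Fin n → Carrier
  restrict s h x = if lookup s x then h x else 1#

  chainWeight-∏ : ∀ h s → chainWeight h s ≡ ∏ (restrict s h)
  chainWeight-∏ h s = foldr-tabulate (λ x → x) (restrict s h)

  prodAll-∏ : (a : Fin (suc r) → Carrier) → prodAll a ≡ ∏ a
  prodAll-∏ a = foldr-tabulate (λ j → j) a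

  restrict-* : ∀ s (u h : Labeling) x →
    restrict s (λ y → u y * h y) x ≈ restrict s u x * restrict s h x
  restrict-* s u h x with lookup s x
  ... | true  = ≈-refl
  ... | false = ≈-sym (*-identityˡ 1#)

  restrict-cong : ∀ s (h h′ : Labeling) x → (T (lookup s x) → h x ≡ h′ x) →
    restrict s h x ≡ restrict s h′ x
  restrict-cong s h h′ x agree with lookup s x
  ... | true  = agree tt
  ... | false = refl

  module Weights (s : Vec Bool n) (maximal : T (isMaximalChain s)) {v : Fin n} (v∈s : T (lookup s v)) where
    open MaximalChain s maximal

    -- The x-th factor of the weight of s under a ∘ rk, placed in row x, column rk x.
    entry : (a : Fin (suc r) → Carrier) → Fin n → Fin (suc r) → Carrier
    entry a x j = if ⌊ rk x ≟ j ⌋ then restrict s (a ∘ rk) x else 1#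

    entry-diag : ∀ a x → entry a x (rk x) ≡ restrict s (a ∘ rk) x
    entry-diag a x with rk x ≟ rk x
    ... | yes _ = refl
    ... | no rkx≢rkx = ⊥-elim (rkx≢rkx refl)

    entry-off : ∀ a x j → (InChain x → rk x ≡ j → ⊥) → entry a x j ≈ 1#
    entry-off a x j excluded with rk x ≟ j
    ... | yes rkx≡j = reflexive (if-¬T (λ x∈s → excluded x∈s rkx≡j))
    ... | no _      = ≈-refl

    -- s meets each rank exactly once, so the ranks of its members list a₀,…,a_r once each:
    -- both row and column products of `entry a` pick out a single factor.
    rank-product : (a : Fin (suc r) → Carrier) → ∏ (restrict s (a ∘ rk)) ≈ ∏ a
    rank-product a = begin
      ∏ (restrict s (a ∘ rk))             ≈⟨ sum-cong-≋ (λ x → ≈-sym (row x)) ⟩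
      ∏ (λ x → ∏ (entry a x))             ≈⟨ ∏-comm (entry a) ⟩
      ∏ (λ j → ∏ (λ x → entry a x j))     ≈⟨ sum-cong-≋ column ⟩
      ∏ a                                 ∎
      where
      row : ∀ x → ∏ (entry a x) ≈ restrict s (a ∘ rk) x
      row x = ≈-trans (∏-single (entry a x) (rk x) (λ j j≢rkx → entry-off a x j (λ _ → j≢rkx ∘ sym)))
                      (reflexive (entry-diag a x))
      column : ∀ j → ∏ (λ x → entry a x j) ≈ a j
      column j with element-of-rank v∈s j
      ... | e , e∈s , refl = ≈-trans
        (∏-single (λ x → entry a x (rk e)) e
           (λ x x≢e → entry-off a x (rk e) (λ x∈s rkx≡rke → x≢e (rank-injective x∈s e∈s rkx≡rke))))
        (reflexive (trans (entry-diag a e) (if-T e∈s)))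

    weight-rescale : (a : Fin (suc r) → Carrier) (h : Labeling) →
      chainWeight (rescale rk a h) s ≈ prodAll a * chainWeight h s
    weight-rescale a h = begin
      chainWeight (rescale rk a h) s                   ≡⟨ chainWeight-∏ (rescale rk a h) s ⟩
      ∏ (restrict s (rescale rk a h))                  ≈⟨ sum-cong-≋ (restrict-* s (a ∘ rk) h) ⟩
      ∏ (λ x → restrict s (a ∘ rk) x * restrict s h x) ≈⟨ ∏-distrib-* (restrict s (a ∘ rk)) (restrict s h) ⟩
      ∏ (restrict s (a ∘ rk)) * ∏ (restrict s h)       ≈⟨ *-cong (rank-product a) ≈-refl ⟩
      ∏ a * ∏ (restrict s h)                           ≡⟨ sym (cong₂ _*_ (prodAll-∏ a) (chainWeight-∏ h s)) ⟩
      prodAll a * chainWeight h s                      ∎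

    -- Members of s other than v have ranks different from that of v.
    weight-local : (h h′ : Labeling) → (∀ w → w ≡ v ⊎ rk w ≢ rk v → h w ≡ h′ w) →
      chainWeight h s ≡ chainWeight h′ s
    weight-local h h′ agree =
      trans (chainWeight-∏ h s) (trans (sum-cong-≗ same-factors) (sym (chainWeight-∏ h′ s)))
      where
      other-or-v : ∀ x → InChain x → x ≡ v ⊎ rk x ≢ rk v
      other-or-v x x∈s with x ≟ v
      ... | yes x≡v = inj₁ x≡v
      ... | no  x≢v = inj₂ (x≢v ∘ rank-injective x∈s v∈s)
      same-factors : ∀ x → restrict s h x ≡ restrict s h′ x
      same-factors x = restrict-cong s h h′ x (agree x ∘ other-or-v x)

  prodAll-≉0 : (a : Fin (suc r) → Carrier) → (∀ j → a j ≉0) → prodAll a ≉0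
  prodAll-≉0 a a≉0 A≈0 = ∏-≉0 a a≉0 (≈-trans (reflexive (sym (prodAll-∏ a))) A≈0)

  Σ-scale : ∀ {X : Set} (xs : List X) (f g : X → Carrier) (k : Carrier) →
    (∀ {x} → x List.∈ xs → f x ≈ k * g x) → Σ (map f xs) ≈ k * Σ (map g xs)
  Σ-scale []       f g k _      = ≈-sym (zeroʳ k)
  Σ-scale (x ∷ xs) f g k scaled =
    ≈-trans (+-cong (scaled (here refl)) (Σ-scale xs f g k (scaled ∘ there))) (≈-sym (distribˡ k _ _))

  through⁻ : ∀ v {s} → s List.∈ maximalChainsThrough v → T (isMaximalChain s) × T (lookup s v)
  through⁻ v m =
    to T-∧ (proj₂ (∈-filter⁻ (λ s → T? (isMaximalChain s ∧ lookup s v)) {xs = allSubsets n} m))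

  chainSum-rescale : (a : Fin (suc r) → Carrier) (h : Labeling) (v : Fin n) →
    chainSum (rescale rk a h) v ≈ prodAll a * chainSum h v
  chainSum-rescale a h v = Σ-scale (maximalChainsThrough v) _ _ (prodAll a)
    (λ {s} m → let (maximal , v∈s) = through⁻ v m in Weights.weight-rescale s maximal v∈s a h)

  chainSum-local : (h h′ : Labeling) (v : Fin n) → (∀ w → w ≡ v ⊎ rk w ≢ rk v → h w ≡ h′ w) →
    chainSum h v ≡ chainSum h′ v
  chainSum-local h h′ v agree = cong Σ (map-cong-local (All.tabulate
    (λ {s} m → let (maximal , v∈s) = through⁻ v m in Weights.weight-local s maximal v∈s h h′ agree)))

-- The rank toggle τ⟨i⟩, a sequence of toggles at the rank-i elements, acts in
-- parallel: each toggle reads only its own label and labels of other ranks,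
-- none of which the earlier toggles in the sequence have changed.
module RankToggles {c ℓ} (K : Field c ℓ) {n : ℕ} (P : FinPoset n)
                   {r : ℕ} {rk : Fin n → Fin (suc r)} (G : IsGraded P r rk)
                   (C : Field.Carrier K) (i : Fin (suc r)) where
  open Field K using (Carrier; _*_; _⁻¹)
  open Toggles K P
  open ChainSums K P G using (chainSum-local)

  toggle-at : ∀ v g → toggle C v g v ≡ C * chainSum g v ⁻¹
  toggle-at v g with v ≟ v
  ... | yes _   = refl
  ... | no v≢v  = ⊥-elim (v≢v refl)

  toggle-away : ∀ {v w} g → w ≢ v → toggle C v g w ≡ g w
  toggle-away {v} {w} g w≢v with w ≟ v
  ... | yes w≡v = ⊥-elim (w≢v w≡v)
  ... | no _    = refl

  replaceAt-at : ∀ (a : Fin (suc r) → Carrier) b {j} → j ≡ i → replaceAt a i b j ≡ b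
  replaceAt-at a b {j} j≡i with j ≟ i
  ... | yes _   = refl
  ... | no j≢i  = ⊥-elim (j≢i j≡i)

  replaceAt-away : ∀ (a : Fin (suc r) → Carrier) b {j} → j ≢ i → replaceAt a i b j ≡ a j
  replaceAt-away a b {j} j≢i with j ≟ i
  ... | yes j≡i = ⊥-elim (j≢i j≡i)
  ... | no _    = refl

  toggleAll : List (Fin n) → Labeling → Labeling
  toggleAll L g = foldr (λ x h → if ⌊ rk x ≟ i ⌋ then toggle C x h else h) g L

  frame : ∀ L g w → ¬ (w List.∈ L × rk w ≡ i) → toggleAll L g w ≡ g w
  frame []      g w _   = refl
  frame (x ∷ L) g w out with rk x ≟ i
  ... | no _ = frame L g w (λ (w∈L , rkw≡i) → out (there w∈L , rkw≡i))
  ... | yes rkx≡i =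
    trans (toggle-away (toggleAll L g) w≢x) (frame L g w (λ (w∈L , rkw≡i) → out (there w∈L , rkw≡i)))
    where
    w≢x : w ≢ x
    w≢x refl = out (here refl , rkx≡i)

  parallel : ∀ L → Unique L → ∀ g {w} → w List.∈ L → rk w ≡ i →
    toggleAll L g w ≡ C * chainSum g w ⁻¹
  parallel (x ∷ L) (x∉L ∷ unique) g (here refl) rkx≡i with rk x ≟ i
  ... | no rkx≢i = ⊥-elim (rkx≢i rkx≡i)
  ... | yes _    =
    trans (toggle-at x (toggleAll L g)) (cong (λ S → C * S ⁻¹) (chainSum-local _ g x unchanged))
    where
    unchanged : ∀ w → w ≡ x ⊎ rk w ≢ rk x → toggleAll L g w ≡ g w
    unchanged w relevant = frame L g w λ (w∈L , rkw≡i) → excluded relevant w∈L rkw≡i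
      where
      excluded : w ≡ x ⊎ rk w ≢ rk x → w List.∈ L → rk w ≡ i → ⊥
      excluded (inj₁ refl)    w∈L _     = All.lookup x∉L w∈L refl
      excluded (inj₂ rkw≢rkx) _   rkw≡i = rkw≢rkx (trans rkw≡i (sym rkx≡i))
  parallel (x ∷ L) (x∉L ∷ unique) g {w} (there w∈L) rkw≡i with rk x ≟ i
  ... | no _ = parallel L unique g w∈L rkw≡i
  ... | yes _ = trans (toggle-away (toggleAll L g) w≢x) (parallel L unique g w∈L rkw≡i)
    where
    w≢x : w ≢ x
    w≢x refl = All.lookup x∉L w∈L refl

  rankToggle-at : ∀ g {w} → rk w ≡ i → rankToggle rk C i g w ≡ C * chainSum g w ⁻¹
  rankToggle-at g {w} = parallel (List.allFin n) (allFin⁺ n) g (∈-allFin w)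

  rankToggle-away : ∀ g {w} → rk w ≢ i → rankToggle rk C i g w ≡ g w
  rankToggle-away g {w} rkw≢i = frame (List.allFin n) g w (rkw≢i ∘ proj₂)

proposition4p6 : ∀ {c ℓ} (K : Field c ℓ) → CharacteristicZero K →
    ∀ {n : ℕ} (P : FinPoset n) (r : ℕ) (rk : Fin n → Fin (suc r)) → IsGraded P r rk →
    let open Field K
        open Toggles K P
    in (C : Carrier) → ¬ (C ≈ 0#) →
       (g : Labeling) (a : Fin (suc r) → Carrier) → (∀ j → ¬ (a j ≈ 0#)) →
       (i : Fin (suc r)) →
       (∀ v → rk v ≡ i → ¬ (chainSum g v ≈ 0#)) →
       rankToggle rk C i (rescale rk a g)
         ≋ rescale rk (replaceAt a i (prodAll a ⁻¹)) (rankToggle rk C i g)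
proposition4p6 K _ P r rk G C _ g a a≉0 i chainSum≉0 x = by-rank (rk x ≟ i)
  where
  open Field K using (Carrier; _≈_; _*_; _⁻¹; setoid)
  open Toggles K P
  open import Relation.Binary.Reasoning.Setoid setoid
  open FieldFacts K using (reciprocal-rescale)
  open ChainSums K P G using (chainSum-rescale; prodAll-≉0)
  open RankToggles K P G C i using (rankToggle-at; rankToggle-away; replaceAt-at; replaceAt-away)

  A : Carrier
  A = prodAll a

  by-rank : Dec (rk x ≡ i) →
    rankToggle rk C i (rescale rk a g) x ≈ replaceAt a i (A ⁻¹) (rk x) * rankToggle rk C i g x
  by-rank (yes rkx≡i) = begin
    rankToggle rk C i (rescale rk a g) x   ≡⟨ rankToggle-at (rescale rk a g) rkx≡i ⟩
    C * chainSum (rescale rk a g) x ⁻¹     ≈⟨ reciprocal-rescale C (prodAll-≉0 a a≉0) (chainSum≉0 x rkx≡i)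
                                                                 (chainSum-rescale a g x) ⟩
    A ⁻¹ * (C * chainSum g x ⁻¹)           ≡⟨ cong₂ _*_ (replaceAt-at a (A ⁻¹) rkx≡i) (rankToggle-at g rkx≡i) ⟨
    replaceAt a i (A ⁻¹) (rk x) * rankToggle rk C i g x ∎
  by-rank (no rkx≢i) = begin
    rankToggle rk C i (rescale rk a g) x   ≡⟨ rankToggle-away (rescale rk a g) rkx≢i ⟩
    a (rk x) * g x                         ≡⟨ cong₂ _*_ (replaceAt-away a (A ⁻¹) rkx≢i) (rankToggle-away g rkx≢i) ⟨
    replaceAt a i (A ⁻¹) (rk x) * rankToggle rk C i g x ∎
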